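{- For any $\mathcal{L}_{\mathrm{RBL}}$-formulae $A$ and $B$, if $\top\Rightarrow A\vee B$ is derivable in $\mathsf{L_{RBL}}$, then $\top\Rightarrow A$ or $\top\Rightarrow B$ is derivable in $\mathsf{L_{RBL}}$.
   Context: $\mathcal{L}_{\mathrm{RBL}}$-formulae are built from propositional letters by $\bot,\top,\wedge,\vee,\cdot,\rightarrow,\leftarrow$. $\mathsf{L_{RBL}}$ is the sequent calculus for sequents $\Gamma\Rightarrow A$ over formula structures built with $\odot$ (structural $\cdot$) and $\mathbin{\bar{\wedge}}$ (structural $\wedge$): axioms $A\Rightarrow A$, $A\Rightarrow\top$, $\bot\Rightarrow A$; left/right rules for $\rightarrow,\leftarrow,\cdot,\wedge,\vee$ (with $(\vee R)$: from $\Gamma\Rightarrow A_i$ infer $\Gamma\Rightarrow A_1\vee A_2$); contraction, exchange, associativity for $\mathbin{\bar{\wedge}}$; restricted $\odot$-contraction from $\Gamma[(\Lambda\odot\Delta)\odot\Delta]\Rightarrow A$ to $\Gamma[\Lambda\odot\Delta]\Rightarrow A$ ($\Lambda$ nonempty); weakening for $\odot$ and $\mathbin{\bar{\wedge}}$; Cut. Cut (equivalently the Mix rule) is eliminable except when the cut formula is $\bot$ or $\top$. -}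

module Defs where

open import Data.Nat using (ℕ)

infixr 6 _⇒ᶠ_
infixl 6 _⇐ᶠ_
infixr 7 _∧ᶠ_ _∨ᶠ_ _·ᶠ_

data Fm : Set where
  var    : ℕ → Fm
  ⊥ᶠ ⊤ᶠ  : Fm
  _∧ᶠ_ _∨ᶠ_ _·ᶠ_ : Fm → Fm → Fm
  _⇒ᶠ_   : Fm → Fm → Fm
  _⇐ᶠ_   : Fm → Fm → Fm

data Str : Set where
  ⌊_⌋  : Fm → Str
  _⊙_  : Str → Str → Str
  _∧̄_  : Str → Str → Str

data Ctx : Set where
  ∙     : Ctx
  _⊙ˡ_  : Ctx → Str → Ctx
  _⊙ʳ_  : Str → Ctx → Ctx
  _∧̄ˡ_  : Ctx → Str → Ctx
  _∧̄ʳ_  : Str → Ctx → Ctx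

_[_] : Ctx → Str → Str
∙ [ Δ ] = Δ
(Γ ⊙ˡ Λ) [ Δ ] = (Γ [ Δ ]) ⊙ Λ
(Λ ⊙ʳ Γ) [ Δ ] = Λ ⊙ (Γ [ Δ ])
(Γ ∧̄ˡ Λ) [ Δ ] = (Γ [ Δ ]) ∧̄ Λ
(Λ ∧̄ʳ Γ) [ Δ ] = Λ ∧̄ (Γ [ Δ ])

infix 4 _⊢_
data _⊢_ : Str → Fm → Set where
  id   : ∀ {A} → ⌊ A ⌋ ⊢ A
  ⊤ax  : ∀ {A} → ⌊ A ⌋ ⊢ ⊤ᶠ
  ⊥ax  : ∀ {A} → ⌊ ⊥ᶠ ⌋ ⊢ A
  ⇒L   : ∀ {Γ Δ A B C} → Δ ⊢ A → Γ [ ⌊ B ⌋ ] ⊢ C → Γ [ Δ ⊙ ⌊ A ⇒ᶠ B ⌋ ] ⊢ C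
  ⇒R   : ∀ {Γ A B} → ⌊ A ⌋ ⊙ Γ ⊢ B → Γ ⊢ A ⇒ᶠ B
  ⇐L   : ∀ {Γ Δ A B C} → Δ ⊢ A → Γ [ ⌊ B ⌋ ] ⊢ C → Γ [ ⌊ B ⇐ᶠ A ⌋ ⊙ Δ ] ⊢ C
  ⇐R   : ∀ {Γ A B} → Γ ⊙ ⌊ A ⌋ ⊢ B → Γ ⊢ B ⇐ᶠ A
  ·L   : ∀ {Γ A B C} → Γ [ ⌊ A ⌋ ⊙ ⌊ B ⌋ ] ⊢ C → Γ [ ⌊ A ·ᶠ B ⌋ ] ⊢ C
  ·R   : ∀ {Γ Δ A B} → Γ ⊢ A → Δ ⊢ B → Γ ⊙ Δ ⊢ A ·ᶠ B
  ∧L   : ∀ {Γ A B C} → Γ [ ⌊ A ⌋ ∧̄ ⌊ B ⌋ ] ⊢ C → Γ [ ⌊ A ∧ᶠ B ⌋ ] ⊢ C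
  ∧R   : ∀ {Γ A B} → Γ ⊢ A → Γ ⊢ B → Γ ⊢ A ∧ᶠ B
  ∨L   : ∀ {Γ A B C} → Γ [ ⌊ A ⌋ ] ⊢ C → Γ [ ⌊ B ⌋ ] ⊢ C → Γ [ ⌊ A ∨ᶠ B ⌋ ] ⊢ C
  ∨R₁  : ∀ {Γ A B} → Γ ⊢ A → Γ ⊢ A ∨ᶠ B
  ∨R₂  : ∀ {Γ A B} → Γ ⊢ B → Γ ⊢ A ∨ᶠ B
  ∧̄C   : ∀ {Γ Δ C} → Γ [ Δ ∧̄ Δ ] ⊢ C → Γ [ Δ ] ⊢ C
  ∧̄E   : ∀ {Γ Δ₁ Δ₂ C} → Γ [ Δ₁ ∧̄ Δ₂ ] ⊢ C → Γ [ Δ₂ ∧̄ Δ₁ ] ⊢ C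
  ∧̄A₁  : ∀ {Γ Δ₁ Δ₂ Δ₃ C} → Γ [ (Δ₁ ∧̄ Δ₂) ∧̄ Δ₃ ] ⊢ C → Γ [ Δ₁ ∧̄ (Δ₂ ∧̄ Δ₃) ] ⊢ C
  ∧̄A₂  : ∀ {Γ Δ₁ Δ₂ Δ₃ C} → Γ [ Δ₁ ∧̄ (Δ₂ ∧̄ Δ₃) ] ⊢ C → Γ [ (Δ₁ ∧̄ Δ₂) ∧̄ Δ₃ ] ⊢ C
  -- restricted ⊙-contraction (Λ is a (nonempty) structure)
  ⊙C   : ∀ {Γ Λ Δ C} → Γ [ (Λ ⊙ Δ) ⊙ Δ ] ⊢ C → Γ [ Λ ⊙ Δ ] ⊢ C
  ⊙W₁  : ∀ {Γ Δ Λ C} → Γ [ Δ ] ⊢ C → Γ [ Δ ⊙ Λ ] ⊢ C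
  ⊙W₂  : ∀ {Γ Δ Λ C} → Γ [ Δ ] ⊢ C → Γ [ Λ ⊙ Δ ] ⊢ C
  ∧̄W₁  : ∀ {Γ Δ Λ C} → Γ [ Δ ] ⊢ C → Γ [ Δ ∧̄ Λ ] ⊢ C
  ∧̄W₂  : ∀ {Γ Δ Λ C} → Γ [ Δ ] ⊢ C → Γ [ Λ ∧̄ Δ ] ⊢ C
  cut  : ∀ {Γ Δ A C} → Δ ⊢ A → Γ [ ⌊ A ⌋ ] ⊢ C → Γ [ Δ ] ⊢ C

-- A realizability (gluing) model. Structures are preordered by X ≼ Γ, "X may replace Γ in any
-- derivable sequent", and X ⊩ A demands both X ⊢ A and a Kripke-style clause over ≼ in which
-- X ⊩ A ∨ B means X ⊩ A or X ⊩ B. Every rule, Cut included, preserves realizability, so no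
-- cut elimination is needed (it fails for cuts on ⊤ and ⊥). Since ⌊ ⊤ ⌋ realizes ⊤ outright,
-- a derivation of ⌊ ⊤ ⌋ ⊢ A ∨ B yields a realizer, hence a derivation, of A or of B.
module Submission where

open import Defs
open import Data.Sum using (_⊎_; inj₁; inj₂; map)
open import Data.Product using (Σ; _×_; _,_; proj₁)
open import Data.Unit using (tt) renaming (⊤ to Unit)
open import Data.Empty using () renaming (⊥ to Empty)
open import Relation.Binary.PropositionalEquality using (_≡_; refl; subst; sym; cong)

infixl 5 _∘ᶜ_
infix 4 _≼_ _⊩_ _⊩ˢ_

_∘ᶜ_ : Ctx → Ctx → Ctx
∙ ∘ᶜ Ψ = Ψ
(Γ ⊙ˡ Λ) ∘ᶜ Ψ = (Γ ∘ᶜ Ψ) ⊙ˡ Λ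
(Λ ⊙ʳ Γ) ∘ᶜ Ψ = Λ ⊙ʳ (Γ ∘ᶜ Ψ)
(Γ ∧̄ˡ Λ) ∘ᶜ Ψ = (Γ ∘ᶜ Ψ) ∧̄ˡ Λ
(Λ ∧̄ʳ Γ) ∘ᶜ Ψ = Λ ∧̄ʳ (Γ ∘ᶜ Ψ)

∘ᶜ-[] : ∀ Θ Ψ X → (Θ ∘ᶜ Ψ) [ X ] ≡ Θ [ Ψ [ X ] ]
∘ᶜ-[] ∙ Ψ X = refl
∘ᶜ-[] (Γ ⊙ˡ Λ) Ψ X = cong (_⊙ Λ) (∘ᶜ-[] Γ Ψ X)
∘ᶜ-[] (Λ ⊙ʳ Γ) Ψ X = cong (Λ ⊙_) (∘ᶜ-[] Γ Ψ X)
∘ᶜ-[] (Γ ∧̄ˡ Λ) Ψ X = cong (_∧̄ Λ) (∘ᶜ-[] Γ Ψ X)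
∘ᶜ-[] (Λ ∧̄ʳ Γ) Ψ X = cong (Λ ∧̄_) (∘ᶜ-[] Γ Ψ X)

_≼_ : Str → Str → Set
X ≼ Γ = ∀ Θ C → Θ [ Γ ] ⊢ C → Θ [ X ] ⊢ C

≼-refl : ∀ {X} → X ≼ X
≼-refl Θ C d = d

≼-trans : ∀ {X Y Z} → X ≼ Y → Y ≼ Z → X ≼ Z
≼-trans p q Θ C d = p Θ C (q Θ C d)

≼-[] : ∀ {X Y} Ψ → X ≼ Y → Ψ [ X ] ≼ Ψ [ Y ]
≼-[] {X} {Y} Ψ p Θ C d =
  subst (_⊢ C) (∘ᶜ-[] Θ Ψ X) (p (Θ ∘ᶜ Ψ) C (subst (_⊢ C) (sym (∘ᶜ-[] Θ Ψ Y)) d))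

⊙-mono : ∀ {X Y Γ Δ} → X ≼ Γ → Y ≼ Δ → X ⊙ Y ≼ Γ ⊙ Δ
⊙-mono p q = ≼-trans (≼-[] (∙ ⊙ˡ _) p) (≼-[] (_ ⊙ʳ ∙) q)

∧̄-mono : ∀ {X Y Γ Δ} → X ≼ Γ → Y ≼ Δ → X ∧̄ Y ≼ Γ ∧̄ Δ
∧̄-mono p q = ≼-trans (≼-[] (∙ ∧̄ˡ _) p) (≼-[] (_ ∧̄ʳ ∙) q)

≼-∧̄ : ∀ {X Γ Δ} → X ≼ Γ → X ≼ Δ → X ≼ Γ ∧̄ Δ
≼-∧̄ {X} p q = ≼-trans (λ Θ C d → ∧̄C {Θ} {X} d) (∧̄-mono p q)

⊙≼ˡ : ∀ {Y Z} → Y ⊙ Z ≼ Y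
⊙≼ˡ {Y} {Z} Θ C d = ⊙W₁ {Θ} {Y} {Z} d

⊙≼ʳ : ∀ {Y Z} → Y ⊙ Z ≼ Z
⊙≼ʳ {Y} {Z} Θ C d = ⊙W₂ {Θ} {Z} {Y} d

⊙-contract : ∀ {Y Z} → Y ⊙ Z ≼ (Y ⊙ Z) ⊙ Z
⊙-contract {Y} {Z} Θ C d = ⊙C {Θ} {Y} {Z} d

⊢⇒≼ : ∀ {X A} → X ⊢ A → X ≼ ⌊ A ⌋
⊢⇒≼ d Θ C e = cut {Θ} d e

≼-⊢ : ∀ {X Γ C} → X ≼ Γ → Γ ⊢ C → X ⊢ C
≼-⊢ p d = p ∙ _ d

mutual
  _⊩_ : Str → Fm → Set
  X ⊩ A = (X ⊢ A) × ⟦ A ⟧ X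

  ⟦_⟧ : Fm → Str → Set
  ⟦ var n ⟧ X = Unit
  ⟦ ⊥ᶠ ⟧ X = Empty
  ⟦ ⊤ᶠ ⟧ X = Unit
  ⟦ A ∧ᶠ B ⟧ X = X ⊩ A × X ⊩ B
  ⟦ A ∨ᶠ B ⟧ X = X ⊩ A ⊎ X ⊩ B
  ⟦ A ·ᶠ B ⟧ X = Σ Str λ Y → Σ Str λ Z → X ≼ Y ⊙ Z × Y ⊩ A × Z ⊩ B
  ⟦ A ⇒ᶠ B ⟧ X = ∀ Y → Y ⊩ A → Y ⊙ X ⊩ B
  ⟦ B ⇐ᶠ A ⟧ X = ∀ Y → Y ⊩ A → X ⊙ Y ⊩ B

_⊩ˢ_ : Str → Str → Set
X ⊩ˢ ⌊ A ⌋ = X ⊩ A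
X ⊩ˢ Δ ⊙ Λ = Σ Str λ Y → Σ Str λ Z → X ≼ Y ⊙ Z × Y ⊩ˢ Δ × Z ⊩ˢ Λ
X ⊩ˢ Δ ∧̄ Λ = X ⊩ˢ Δ × X ⊩ˢ Λ

⟦⟧-mono : ∀ {X Y} A → X ≼ Y → ⟦ A ⟧ Y → ⟦ A ⟧ X
⊩-mono : ∀ {X Y} A → X ≼ Y → Y ⊩ A → X ⊩ A
⊩-mono A p (d , s) = ≼-⊢ p d , ⟦⟧-mono A p s
⟦⟧-mono (var n) p s = tt
⟦⟧-mono ⊥ᶠ p ()
⟦⟧-mono ⊤ᶠ p s = tt
⟦⟧-mono (A ∧ᶠ B) p (a , b) = ⊩-mono A p a , ⊩-mono B p b
⟦⟧-mono (A ∨ᶠ B) p s = map (⊩-mono A p) (⊩-mono B p) s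
⟦⟧-mono (A ·ᶠ B) p (Y , Z , q , a , b) = Y , Z , ≼-trans p q , a , b
⟦⟧-mono (A ⇒ᶠ B) p f Y a = ⊩-mono B (⊙-mono ≼-refl p) (f Y a)
⟦⟧-mono (B ⇐ᶠ A) p f Y a = ⊩-mono B (⊙-mono p ≼-refl) (f Y a)

⊩ˢ-mono : ∀ {X Y} Γ → X ≼ Y → Y ⊩ˢ Γ → X ⊩ˢ Γ
⊩ˢ-mono ⌊ A ⌋ p a = ⊩-mono A p a
⊩ˢ-mono (Δ ⊙ Λ) p (Y , Z , q , a , b) = Y , Z , ≼-trans p q , a , b
⊩ˢ-mono (Δ ∧̄ Λ) p (a , b) = ⊩ˢ-mono Δ p a , ⊩ˢ-mono Λ p b

⊩ˢ⇒≼ : ∀ {X} Γ → X ⊩ˢ Γ → X ≼ Γ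
⊩ˢ⇒≼ ⌊ A ⌋ (d , _) = ⊢⇒≼ d
⊩ˢ⇒≼ (Δ ⊙ Λ) (Y , Z , q , a , b) = ≼-trans q (⊙-mono (⊩ˢ⇒≼ Δ a) (⊩ˢ⇒≼ Λ b))
⊩ˢ⇒≼ (Δ ∧̄ Λ) (a , b) = ≼-∧̄ (⊩ˢ⇒≼ Δ a) (⊩ˢ⇒≼ Λ b)

⊩ˢ-[] : ∀ {P Q} Γ → (∀ X → X ⊩ˢ P → X ⊩ˢ Q) → ∀ X → X ⊩ˢ Γ [ P ] → X ⊩ˢ Γ [ Q ]
⊩ˢ-[] ∙ f X h = f X h
⊩ˢ-[] (Γ ⊙ˡ Λ) f X (Y , Z , q , a , b) = Y , Z , q , ⊩ˢ-[] Γ f Y a , b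
⊩ˢ-[] (Λ ⊙ʳ Γ) f X (Y , Z , q , a , b) = Y , Z , q , a , ⊩ˢ-[] Γ f Z b
⊩ˢ-[] (Γ ∧̄ˡ Λ) f X (a , b) = ⊩ˢ-[] Γ f X a , b
⊩ˢ-[] (Λ ∧̄ʳ Γ) f X (a , b) = a , ⊩ˢ-[] Γ f X b

⊩ˢ-[]-⊎ : ∀ {P Q R} Γ → (∀ X → X ⊩ˢ P → X ⊩ˢ Q ⊎ X ⊩ˢ R) →
          ∀ X → X ⊩ˢ Γ [ P ] → X ⊩ˢ Γ [ Q ] ⊎ X ⊩ˢ Γ [ R ]
⊩ˢ-[]-⊎ ∙ f X h = f X h
⊩ˢ-[]-⊎ (Γ ⊙ˡ Λ) f X (Y , Z , q , a , b) =
  map (λ a′ → Y , Z , q , a′ , b) (λ a′ → Y , Z , q , a′ , b) (⊩ˢ-[]-⊎ Γ f Y a)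
⊩ˢ-[]-⊎ (Λ ⊙ʳ Γ) f X (Y , Z , q , a , b) =
  map (λ b′ → Y , Z , q , a , b′) (λ b′ → Y , Z , q , a , b′) (⊩ˢ-[]-⊎ Γ f Z b)
⊩ˢ-[]-⊎ (Γ ∧̄ˡ Λ) f X (a , b) = map (_, b) (_, b) (⊩ˢ-[]-⊎ Γ f X a)
⊩ˢ-[]-⊎ (Λ ∧̄ʳ Γ) f X (a , b) = map (a ,_) (a ,_) (⊩ˢ-[]-⊎ Γ f X b)

⊩-sound : ∀ {Γ C} → Γ ⊢ C → ∀ X → X ⊩ˢ Γ → X ⊩ C
⟦⟧-sound : ∀ {Γ C} → Γ ⊢ C → ∀ X → X ⊩ˢ Γ → ⟦ C ⟧ X
⊩-sound {Γ} d X h = ≼-⊢ (⊩ˢ⇒≼ Γ h) d , ⟦⟧-sound d X h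

⟦⟧-sound id X (_ , s) = s
⟦⟧-sound ⊤ax X h = tt
⟦⟧-sound ⊥ax X (_ , ())
⟦⟧-sound (⇒L {Γ} {B = B} d e) X h =
  ⟦⟧-sound e X (⊩ˢ-[] Γ (λ _ (Y , Z , q , a , (_ , f)) → ⊩-mono B q (f Y (⊩-sound d Y a))) X h)
⟦⟧-sound (⇒R d) X h Y a = ⊩-sound d (Y ⊙ X) (Y , X , ≼-refl , a , h)
⟦⟧-sound (⇐L {Γ} {B = B} d e) X h =
  ⟦⟧-sound e X (⊩ˢ-[] Γ (λ _ (Y , Z , q , (_ , f) , a) → ⊩-mono B q (f Z (⊩-sound d Z a))) X h)
⟦⟧-sound (⇐R d) X h Y a = ⊩-sound d (X ⊙ Y) (X , Y , ≼-refl , h , a)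
⟦⟧-sound (·L {Γ} d) X h = ⟦⟧-sound d X (⊩ˢ-[] Γ (λ _ (_ , s) → s) X h)
⟦⟧-sound (·R d e) X (Y , Z , q , a , b) = Y , Z , q , ⊩-sound d Y a , ⊩-sound e Z b
⟦⟧-sound (∧L {Γ} d) X h = ⟦⟧-sound d X (⊩ˢ-[] Γ (λ _ (_ , s) → s) X h)
⟦⟧-sound (∧R d e) X h = ⊩-sound d X h , ⊩-sound e X h
⟦⟧-sound (∨L {Γ} d e) X h with ⊩ˢ-[]-⊎ Γ (λ _ (_ , s) → s) X h
... | inj₁ a = ⟦⟧-sound d X a
... | inj₂ b = ⟦⟧-sound e X b
⟦⟧-sound (∨R₁ d) X h = inj₁ (⊩-sound d X h)
⟦⟧-sound (∨R₂ d) X h = inj₂ (⊩-sound d X h)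
⟦⟧-sound (∧̄C {Γ} d) X h = ⟦⟧-sound d X (⊩ˢ-[] Γ (λ _ a → a , a) X h)
⟦⟧-sound (∧̄E {Γ} d) X h = ⟦⟧-sound d X (⊩ˢ-[] Γ (λ _ (a , b) → b , a) X h)
⟦⟧-sound (∧̄A₁ {Γ} d) X h = ⟦⟧-sound d X (⊩ˢ-[] Γ (λ _ (a , b , c) → (a , b) , c) X h)
⟦⟧-sound (∧̄A₂ {Γ} d) X h = ⟦⟧-sound d X (⊩ˢ-[] Γ (λ _ ((a , b) , c) → a , b , c) X h)
⟦⟧-sound (⊙C {Γ} d) X h =
  ⟦⟧-sound d X (⊩ˢ-[] Γ (λ _ (Y , Z , q , a , b) →
    Y ⊙ Z , Z , ≼-trans q ⊙-contract , (Y , Z , ≼-refl , a , b) , b) X h)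
⟦⟧-sound (⊙W₁ {Γ} {Δ} d) X h =
  ⟦⟧-sound d X (⊩ˢ-[] Γ (λ _ (Y , Z , q , a , b) → ⊩ˢ-mono Δ (≼-trans q ⊙≼ˡ) a) X h)
⟦⟧-sound (⊙W₂ {Γ} {Δ} d) X h =
  ⟦⟧-sound d X (⊩ˢ-[] Γ (λ _ (Y , Z , q , a , b) → ⊩ˢ-mono Δ (≼-trans q ⊙≼ʳ) b) X h)
⟦⟧-sound (∧̄W₁ {Γ} d) X h = ⟦⟧-sound d X (⊩ˢ-[] Γ (λ _ (a , b) → a) X h)
⟦⟧-sound (∧̄W₂ {Γ} d) X h = ⟦⟧-sound d X (⊩ˢ-[] Γ (λ _ (a , b) → b) X h)
⟦⟧-sound (cut {Γ} d e) X h = ⟦⟧-sound e X (⊩ˢ-[] Γ (λ Y a → ⊩-sound d Y a) X h)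

⊤-⊩ : ⌊ ⊤ᶠ ⌋ ⊩ˢ ⌊ ⊤ᶠ ⌋
⊤-⊩ = id , tt

theorem8 : (A B : Fm) → ⌊ ⊤ᶠ ⌋ ⊢ A ∨ᶠ B → (⌊ ⊤ᶠ ⌋ ⊢ A) ⊎ (⌊ ⊤ᶠ ⌋ ⊢ B)
theorem8 A B d = map proj₁ proj₁ (⟦⟧-sound d ⌊ ⊤ᶠ ⌋ ⊤-⊩)
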